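{- Let $r_p, h_p, r_v, a_{lo}, a_{max}$ be real parameters and $r,h,v,w,v_{lo}$ real state variables. The following differential game logic formula is valid (true in every state): $$\Big(r_p\ge 0\wedge h_p>0\wedge r_v\ge 0\wedge a_{lo}>0\wedge (w=-1\vee w=1)\wedge a_{max}\ge a_{lo}\wedge L^{ -1}_{impl}(r,h,v,w,v_{lo})\Big)\ \to\ [\alpha_1^*]\big(|r|>r_p\vee |h|>h_p\big),$$ where $$\alpha_1 \equiv \Big(?\mathit{true}\ \cup\ \big((w:=1\cup w:=-1);\ v_{lo}:=*;\ ?L^{ -1}_{impl}(r,h,v,w,v_{lo});\ \mathit{adv}:=(w,v_{lo})\big)\Big);\ \big(a_o:=*;\ ?(-a_{max}\le a_o\le a_{max})\big)^d;\ \{r'=-r_v,\ h'=-v,\ v'=a_o\}.$$ That is, from every state satisfying the precondition, the ownship has a winning strategy in this game that guarantees $|r|>r_p\vee|h|>h_p$ (no near mid-air collision) throughout.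
   Context: Game semantics (differential game logic dGL). A hybrid game is played between the ownship (the player who must establish the postcondition) and the opponent. A formula $P\to[\alpha]Q$ is valid iff from every state (assignment of reals to all variables) satisfying $P$ the ownship has a strategy in game $\alpha$ such that every play it allows ends (whenever it ends) in a state satisfying $Q$. Game constructs: $x:=e$ assigns the value of $e$ to $x$; $x:=*$ lets the opponent pick an arbitrary real value for $x$; $?\phi$ is a test: if $\phi$ is false in the current state the opponent loses; $\alpha;\beta$ plays $\alpha$ then $\beta$; $\alpha\cup\beta$ lets the opponent choose which of $\alpha,\beta$ to play; $\alpha^*$ lets the opponent decide, before each round, whether to play another round of $\alpha$ or stop (so $Q$ must hold after every finite number of rounds the opponent may choose, including zero); $\{x'=f(x)\ \&\ D\}$ evolves the variables along the solution of the differential equations for a nonnegative duration chosen by the opponent, such that $D$ holds throughout (no domain means $D\equiv\mathit{true}$); $\alpha^d$ (dual) swaps the roles inside $\alpha$: there the ownship makes all choices (e.g. the value in $x:=*$), and a failed test makes the ownship lose. The assignment $\mathit{adv}:=(w,v_{lo})$ is a bookkeeping assignment to a variable not occurring elsewhere. Interpretation: $r$ horizontal and $h$ vertical separation of the intruder relative to the ownship, $v$ relative vertical velocity, $r_v$ horizontal closure rate, $a_o$ ownship vertical acceleration, $(w,v_{lo})$ the advisory (direction $w=\pm1$, target relative climb rate $v_{lo}$), $a_{lo}$ minimal advisory-compliant acceleration, $a_{max}$ ownship acceleration limit, $r_p,h_p$ puck radius and half-height. Safe region: $T_{lo}(v,w,v_{lo})\equiv \frac{\max(0,w(v_{lo}-v))}{a_{lo}}$;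 $A_{lo}(v,w,v_{lo},h_n,t)\equiv \big(0\le t<T_{lo}(v,w,v_{lo})\wedge h_n=\frac{w a_{lo}}{2}t^2+vt\big)\vee\big(t\ge T_{lo}(v,w,v_{lo})\wedge h_n=v_{lo}t-\frac{w\max(0,w(v_{lo}-v))^2}{2a_{lo}}\big)$; $L^{ -1}_{impl}(r,h,v,w,v_{lo})\equiv \forall t\,\forall r_n\,\forall h_n\big(r_n=r_v t\wedge A_{lo}(v,w,v_{lo},h_n,t)\to(|r-r_n|>r_p\vee w(h_n-h)>h_p)\big)$, where $r_v,a_{lo},r_p,h_p$ are the parameters above. -}

module Defs where

open import Level using (0ℓ)
open import Data.Product using (Σ; ∃; _×_; _,_)
open import Data.Sum using (_⊎_; inj₁; inj₂)
open import Relation.Nullary using (¬_)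
open import Relation.Binary using (Tri; tri<; tri≈; tri>)
open import Relation.Binary.Structures using (IsStrictTotalOrder)
open import Relation.Binary.PropositionalEquality using (_≡_)
open import Algebra.Structures using (IsCommutativeRing)

-- The real numbers, axiomatised as a complete ordered field
-- (unique up to isomorphism, so quantifying over all such is faithful).

record CompleteOrderedField : Set₁ where
  infixl 6 _+_ _-_
  infixl 7 _*_
  infix 4 _<_ _≤_
  field
    Carrier : Set
    _+_ _*_ : Carrier → Carrier → Carrier
    -_      : Carrier → Carrier
    0# 1#   : Carrier
    _⁻¹     : Carrier → Carrier      -- total; value at 0 is irrelevant
    _<_     : Carrier → Carrier → Set
    isCommutativeRing : IsCommutativeRing _≡_ _+_ _*_ -_ 0# 1#
    ⁻¹-inverse : ∀ x → ¬ (x ≡ 0#) → x * (x ⁻¹) ≡ 1#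
    isStrictTotalOrder : IsStrictTotalOrder _≡_ _<_
    0<1 : 0# < 1#
    +-mono-< : ∀ x y z → x < y → x + z < y + z
    *-pos    : ∀ x y → 0# < x → 0# < y → 0# < x * y

  _≤_ : Carrier → Carrier → Set
  x ≤ y = (x < y) ⊎ (x ≡ y)

  _-_ : Carrier → Carrier → Carrier
  x - y = x + (- y)

  field
    complete : (S : Carrier → Set) → (∃ λ x → S x) →
               (∃ λ b → ∀ x → S x → x ≤ b) →
               ∃ λ s → (∀ x → S x → x ≤ s) ×
                       (∀ b → (∀ x → S x → x ≤ b) → s ≤ b)

  max : Carrier → Carrier → Carrier
  max x y with IsStrictTotalOrder.compare isStrictTotalOrder x y
  ... | tri< _ _ _ = y
  ... | tri≈ _ _ _ = y
  ... | tri> _ _ _ = x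

  ∣_∣ : Carrier → Carrier
  ∣ x ∣ = max x (- x)

  2# : Carrier
  2# = 1# + 1#

  _/_ : Carrier → Carrier → Carrier
  x / y = x * (y ⁻¹)

module ACAS (ℝ : CompleteOrderedField) where
  open CompleteOrderedField ℝ

  record Params : Set where
    constructor params
    field rp hp rv alo amax : Carrier

  record State : Set where
    constructor state
    field r h v w vlo ao : Carrier

  module _ (P : Params) where
    open Params P

    Tlo : Carrier → Carrier → Carrier → Carrier
    Tlo v w vlo = max 0# (w * (vlo - v)) / alo

    Alo : Carrier → Carrier → Carrier → Carrier → Carrier → Set
    Alo v w vlo hn t =
      (0# ≤ t × t < Tlo v w vlo × hn ≡ (w * alo / 2#) * (t * t) + v * t)
      ⊎ (Tlo v w vlo ≤ t ×
         hn ≡ vlo * t - w * (max 0# (w * (vlo - v)) * max 0# (w * (vlo - v)))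
                          / (2# * alo))

    Limpl : Carrier → Carrier → Carrier → Carrier → Carrier → Set
    Limpl r h v w vlo = ∀ t rn hn → rn ≡ rv * t → Alo v w vlo hn t →
      (rp < ∣ r - rn ∣) ⊎ (hp < w * (hn - h))

    Pre : State → Set
    Pre s = let open State s in
      0# ≤ rp × 0# < hp × 0# ≤ rv × 0# < alo ×
      (w ≡ - 1# ⊎ w ≡ 1#) × alo ≤ amax × Limpl r h v w vlo

    Safe : State → Set
    Safe s = let open State s in (rp < ∣ r ∣) ⊎ (hp < ∣ h ∣)

    -- [{r'=-rv, h'=-v, v'=ao}] X : all durations t ≥ 0, explicit solution
    BoxODE : (State → Set) → State → Set
    BoxODE X (state r h v w vlo ao) = ∀ t → 0# ≤ t →
      X (state (r - rv * t) (h - (v * t + (ao / 2#) * (t * t)))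
               (v + ao * t) w vlo ao)

    -- [(ao := *; ?(-amax ≤ ao ≤ amax))^d] Y : ownship picks ao and must pass test
    BoxCtrlDual : (State → Set) → State → Set
    BoxCtrlDual Y (state r h v w vlo _) =
      ∃ λ ao → (- amax ≤ ao × ao ≤ amax) × Y (state r h v w vlo ao)

    -- [?true ∪ ((w:=1 ∪ w:=-1); vlo:=*; ?Limpl; adv:=(w,vlo))] Y
    -- (adv is a bookkeeping variable not occurring elsewhere, hence omitted)
    BoxAdv : (State → Set) → State → Set
    BoxAdv Y s@(state r h v _ _ ao) =
      Y s ×
      (∀ w' → (w' ≡ 1# ⊎ w' ≡ - 1#) → ∀ vlo' → Limpl r h v w' vlo' →
        Y (state r h v w' vlo' ao))

    BoxAlpha1 : (State → Set) → State → Set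
    BoxAlpha1 X = BoxAdv (BoxCtrlDual (BoxODE X))

    -- [α₁*] Q as the greatest fixpoint of Z ↦ Q ∧ [α₁]Z
    -- (union of all post-fixpoints, dGL semantics of repetition)
    BoxAlpha1Star : (State → Set) → State → Set₁
    BoxAlpha1Star Q s = Σ (State → Set) λ Z →
      Z s × (∀ s' → Z s' → Q s' × BoxAlpha1 Z s')

{-# OPTIONS --safe #-}
-- The winning strategy keeps the advisory's invariant  w = ±1 ∧ L⁻¹impl  by accelerating with
-- exactly ao = w·alo (admissible as alo ≤ amax).  Write hlo v t for the height of the
-- lower-bound trajectory A_lo from climb rate v.  It is a flow,
--     hlo v (t + s) = hlo v t + hlo (v + w alo t) s,
-- and it never exceeds, in direction w, the ownship's own motion:
--     w · hlo v t ≤ w · (v t + (w alo / 2) t²).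
-- So after the ownship follows ao for time t, the lower-bound trajectory from the new state is
-- at every time s at least as far (in direction w) from the intruder as the old one was at
-- time t + s, which L⁻¹impl already kept out of the puck; a new advisory passes the test
-- L⁻¹impl itself.  At t = 0 the trajectory is at height 0, so L⁻¹impl gives
-- |r| > rp ∨ |h| > hp.
module Submission where

open import Algebra.Bundles using (CommutativeRing)
open import Algebra.Solver.Ring.AlmostCommutativeRing
  using (_-Raw-AlmostCommutative⟶_; fromCommutativeRing)
open import Data.Empty using (⊥-elim)
open import Data.Integer as ℤ using (ℤ; +_; -[1+_]; _⊖_)
open import Data.Integer.Properties using ([1+m]⊖[1+n]≡m⊖n; +◃n≡+n; -◃n≡-n)
open import Data.Maybe as Maybe using (Maybe)
open import Data.Nat as ℕ using (zero; suc)
open import Data.Nat.Properties using (+-suc)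
open import Data.Product using (_×_; _,_)
open import Data.Sum as Sum using (_⊎_; inj₁; inj₂)
open import Level using (0ℓ)
open import Relation.Binary using (tri<; tri≈; tri>)
open import Relation.Binary.Bundles using (StrictTotalOrder)
import Relation.Binary.Construct.StrictToNonStrict as StrictToNonStrict
import Relation.Binary.PropositionalEquality as ≡
open ≡ using (_≡_; _≢_)
open import Relation.Nullary using (¬_)
open import Relation.Nullary.Decidable using (dec⇒maybe)

open import Defs

-- The ring solver decides equality of coefficients by computation, which the abstract carrier
-- of a field does not support; so ℤ is used as coefficient ring, via its embedding into R.
module IntegerCoefficients {c ℓ} (R : CommutativeRing c ℓ) where
  open CommutativeRing R
  open import Algebra.Properties.Ring ring using (-‿distribˡ-*; -‿distribʳ-*)
  open import Algebra.Properties.Group +-group using (ε⁻¹≈ε; ⁻¹-involutive; ⁻¹-anti-homo-∙)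
  open import Algebra.Properties.AbelianGroup +-abelianGroup using (xyx⁻¹≈y; ⁻¹-∙-comm)
  -- The optimised multiplication has 1 ×′ x = x and 2 ×′ x = x + x definitionally, so the
  -- solver's constants con (+ 1), con (+ 2) evaluate to exactly 1# and 1# + 1#.
  open import Algebra.Properties.Semiring.Mult.TCOptimised semiring
    using (1+×; ×-homo-+; ×1-homo-*) renaming (_×_ to _×′_)
  open import Relation.Binary.Reasoning.Setoid setoid

  fromℤ : ℤ → Carrier
  fromℤ (+ n)      = n ×′ 1#
  fromℤ -[1+ n ]   = - (suc n ×′ 1#)

  fromℤ-‿homo : ∀ i → fromℤ (ℤ.- i) ≈ - fromℤ i
  fromℤ-‿homo (+ zero)  = sym ε⁻¹≈ε
  fromℤ-‿homo (+ suc n) = refl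
  fromℤ-‿homo -[1+ n ]  = sym (⁻¹-involutive _)

  [x+y]-[x+z]≈y-z : ∀ x y z → (x + y) - (x + z) ≈ y - z
  [x+y]-[x+z]≈y-z x y z = begin
    (x + y) + - (x + z)     ≈⟨ +-congˡ (⁻¹-anti-homo-∙ x z) ⟩
    (x + y) + (- z + - x)   ≈⟨ +-assoc (x + y) (- z) (- x) ⟨
    (x + y) + - z + - x     ≈⟨ +-congʳ (+-assoc x y (- z)) ⟩
    x + (y - z) + - x       ≈⟨ xyx⁻¹≈y x (y - z) ⟩
    y - z                   ∎

  fromℤ-⊖ : ∀ m n → fromℤ (m ⊖ n) ≈ m ×′ 1# - n ×′ 1#
  fromℤ-⊖ m       zero    = sym (trans (+-congˡ ε⁻¹≈ε) (+-identityʳ _))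
  fromℤ-⊖ zero    (suc n) = sym (+-identityˡ _)
  fromℤ-⊖ (suc m) (suc n) = begin
    fromℤ (suc m ⊖ suc n)          ≡⟨ ≡.cong fromℤ ([1+m]⊖[1+n]≡m⊖n m n) ⟩
    fromℤ (m ⊖ n)                  ≈⟨ fromℤ-⊖ m n ⟩
    m ×′ 1# - n ×′ 1#                ≈⟨ [x+y]-[x+z]≈y-z 1# _ _ ⟨
    (1# + m ×′ 1#) - (1# + n ×′ 1#)  ≈⟨ +-cong (1+× m 1#) (-‿cong (1+× n 1#)) ⟨
    suc m ×′ 1# - suc n ×′ 1#        ∎

  fromℤ-+-homo : ∀ i j → fromℤ (i ℤ.+ j) ≈ fromℤ i + fromℤ j
  fromℤ-+-homo (+ m)    (+ n)    = ×-homo-+ 1# m n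
  fromℤ-+-homo (+ m)    -[1+ n ] = fromℤ-⊖ m (suc n)
  fromℤ-+-homo -[1+ m ] (+ n)    = trans (fromℤ-⊖ n (suc m)) (+-comm _ _)
  fromℤ-+-homo -[1+ m ] -[1+ n ] = begin
    - (suc (suc m ℕ.+ n) ×′ 1#)       ≡⟨ ≡.cong (λ k → - (k ×′ 1#)) (≡.sym (+-suc (suc m) n)) ⟩
    - ((suc m ℕ.+ suc n) ×′ 1#)       ≈⟨ -‿cong (×-homo-+ 1# (suc m) (suc n)) ⟩
    - (suc m ×′ 1# + suc n ×′ 1#)      ≈⟨ ⁻¹-∙-comm _ _ ⟨
    - (suc m ×′ 1#) + - (suc n ×′ 1#)  ∎

  -x*-y≈x*y : ∀ x y → - x * - y ≈ x * y
  -x*-y≈x*y x y = begin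
    - x * - y    ≈⟨ -‿distribˡ-* x (- y) ⟨
    - (x * - y)  ≈⟨ -‿cong (-‿distribʳ-* x y) ⟨
    - - (x * y)  ≈⟨ ⁻¹-involutive (x * y) ⟩
    x * y        ∎

  fromℤ-*-homo : ∀ i j → fromℤ (i ℤ.* j) ≈ fromℤ i * fromℤ j
  fromℤ-*-homo (+ m) (+ n) = begin
    fromℤ (+ m ℤ.* + n)  ≡⟨ ≡.cong fromℤ (+◃n≡+n (m ℕ.* n)) ⟩
    (m ℕ.* n) ×′ 1#       ≈⟨ ×1-homo-* m n ⟩
    m ×′ 1# * n ×′ 1#      ∎
  fromℤ-*-homo (+ m) -[1+ n ] = begin
    fromℤ (+ m ℤ.* -[1+ n ])     ≡⟨ ≡.cong fromℤ (-◃n≡-n (m ℕ.* suc n)) ⟩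
    fromℤ (ℤ.- + (m ℕ.* suc n))  ≈⟨ fromℤ-‿homo (+ (m ℕ.* suc n)) ⟩
    - ((m ℕ.* suc n) ×′ 1#)       ≈⟨ -‿cong (×1-homo-* m (suc n)) ⟩
    - (m ×′ 1# * suc n ×′ 1#)      ≈⟨ -‿distribʳ-* _ _ ⟩
    m ×′ 1# * - (suc n ×′ 1#)      ∎
  fromℤ-*-homo -[1+ m ] (+ n) = begin
    fromℤ (-[1+ m ] ℤ.* + n)     ≡⟨ ≡.cong fromℤ (-◃n≡-n (suc m ℕ.* n)) ⟩
    fromℤ (ℤ.- + (suc m ℕ.* n))  ≈⟨ fromℤ-‿homo (+ (suc m ℕ.* n)) ⟩
    - ((suc m ℕ.* n) ×′ 1#)       ≈⟨ -‿cong (×1-homo-* (suc m) n) ⟩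
    - (suc m ×′ 1# * n ×′ 1#)      ≈⟨ -‿distribˡ-* _ _ ⟩
    - (suc m ×′ 1#) * n ×′ 1#      ∎
  fromℤ-*-homo -[1+ m ] -[1+ n ] = begin
    (suc m ℕ.* suc n) ×′ 1#           ≈⟨ ×1-homo-* (suc m) (suc n) ⟩
    suc m ×′ 1# * suc n ×′ 1#          ≈⟨ -x*-y≈x*y _ _ ⟨
    - (suc m ×′ 1#) * - (suc n ×′ 1#)  ∎

  homomorphism : ℤ.+-*-rawRing -Raw-AlmostCommutative⟶ fromCommutativeRing R
  homomorphism = record
    { ⟦_⟧    = fromℤ
    ; +-homo = fromℤ-+-homo
    ; *-homo = fromℤ-*-homo
    ; -‿homo = fromℤ-‿homo
    ; 0-homo = refl
    ; 1-homo = refl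
    }

  fromℤ-≟ : ∀ i j → Maybe (fromℤ i ≈ fromℤ j)
  fromℤ-≟ i j = Maybe.map (λ { ≡.refl → refl }) (dec⇒maybe (i ℤ.≟ j))

  open import Algebra.Solver.Ring ℤ.+-*-rawRing (fromCommutativeRing R) homomorphism fromℤ-≟ public

module OrderedFieldProperties (ℝ : CompleteOrderedField) where
  open CompleteOrderedField ℝ
  open ≡ using (refl; sym; trans; cong; subst; subst₂; module ≡-Reasoning)

  commutativeRing : CommutativeRing 0ℓ 0ℓ
  commutativeRing = record { isCommutativeRing = isCommutativeRing }

  open CommutativeRing commutativeRing public
    using (+-identityˡ; +-identityʳ; -‿inverseʳ; zeroˡ; zeroʳ)
  open IntegerCoefficients commutativeRing public
    using (solve; _:=_; _:+_; _:-_; _:*_; :-_; con)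

  -- Identities holding only modulo relations e ≡ e′ are reduced to ring identities by
  -- supplying the multipliers k of the relations.
  ≡-modulo : ∀ {x y e e′} k → e ≡ e′ → x ≡ y + (e - e′) * k → x ≡ y
  ≡-modulo {y = y} {e} k refl x≡ =
    trans x≡ (solve 3 (λ y e k → y :+ (e :- e) :* k := y) refl y e k)

  ≡-modulo₂ : ∀ {x y e₁ e₁′ e₂ e₂′} k₁ k₂ → e₁ ≡ e₁′ → e₂ ≡ e₂′ →
              x ≡ y + (e₁ - e₁′) * k₁ + (e₂ - e₂′) * k₂ → x ≡ y
  ≡-modulo₂ {y = y} {e₁} {_} {e₂} k₁ k₂ refl refl x≡ = trans x≡
    (solve 5 (λ y e₁ k₁ e₂ k₂ → y :+ (e₁ :- e₁) :* k₁ :+ (e₂ :- e₂) :* k₂ := y)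
      refl y e₁ k₁ e₂ k₂)

  strictTotalOrder : StrictTotalOrder 0ℓ 0ℓ 0ℓ
  strictTotalOrder = record { isStrictTotalOrder = isStrictTotalOrder }

  open StrictTotalOrder strictTotalOrder public
    using (compare; strictPartialOrder)
    renaming (irrefl to <-irrefl; asym to <-asym; trans to <-trans)
  open import Relation.Binary.Properties.StrictTotalOrder strictTotalOrder public
    using () renaming (refl to ≤-refl; trans to ≤-trans; total to ≤-total)

  <-≤-trans : ∀ {x y z} → x < y → y ≤ z → x < z
  <-≤-trans = StrictToNonStrict.<-≤-trans _≡_ _<_ <-trans (λ { refl x<y → x<y })

  ≤-<-trans : ∀ {x y z} → x ≤ y → y < z → x < z
  ≤-<-trans = StrictToNonStrict.≤-<-trans _≡_ _<_ sym <-trans (λ { refl y<z → y<z })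

  <⇒≱ : ∀ {x y} → x < y → ¬ (y ≤ x)
  <⇒≱ x<y (inj₁ y<x) = <-asym x<y y<x
  <⇒≱ x<y (inj₂ refl) = <-irrefl refl x<y

  ≤∧≢⇒< : ∀ {x y} → x ≤ y → x ≢ y → x < y
  ≤∧≢⇒< (inj₁ x<y) _   = x<y
  ≤∧≢⇒< (inj₂ x≡y) x≢y = ⊥-elim (x≢y x≡y)

  >⇒≢0 : ∀ {x} → 0# < x → x ≢ 0#
  >⇒≢0 0<x x≡0 = <-irrefl (sym x≡0) 0<x

  x<y⇒0<y-x : ∀ {x y} → x < y → 0# < y - x
  x<y⇒0<y-x {x} {y} x<y = subst (_< y - x) (-‿inverseʳ x) (+-mono-< x y (- x) x<y)

  +-monoˡ-≤ : ∀ {x y} z → x ≤ y → x + z ≤ y + z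
  +-monoˡ-≤ {x} {y} z (inj₁ x<y) = inj₁ (+-mono-< x y z x<y)
  +-monoˡ-≤ z (inj₂ refl) = ≤-refl

  x≤y⇒0≤y-x : ∀ {x y} → x ≤ y → 0# ≤ y - x
  x≤y⇒0≤y-x {x} x≤y = subst (_≤ _) (-‿inverseʳ x) (+-monoˡ-≤ (- x) x≤y)

  x≤y⇒x-y≤0 : ∀ {x y} → x ≤ y → x - y ≤ 0#
  x≤y⇒x-y≤0 {y = y} x≤y = subst (_ ≤_) (-‿inverseʳ y) (+-monoˡ-≤ (- y) x≤y)

  0≤y-x⇒x≤y : ∀ {x y} → 0# ≤ y - x → x ≤ y
  0≤y-x⇒x≤y {x} {y} 0≤y-x = subst₂ _≤_ (+-identityˡ x)
    (solve 2 (λ x y → y :- x :+ x := y) refl x y) (+-monoˡ-≤ x 0≤y-x)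

  neg-mono-≤ : ∀ {x y} → x ≤ y → - y ≤ - x
  neg-mono-≤ {x} {y} x≤y = subst₂ _≤_
    (solve 2 (λ x y → x :+ (:- x :- y) := :- y) refl x y)
    (solve 2 (λ x y → y :+ (:- x :- y) := :- x) refl x y)
    (+-monoˡ-≤ (- x - y) x≤y)

  -x≤x : ∀ {x} → 0# ≤ x → - x ≤ x
  -x≤x {x} 0≤x =
    ≤-trans (subst (- x ≤_) (solve 0 (:- con (+ 0) := con (+ 0)) refl) (neg-mono-≤ 0≤x)) 0≤x

  +-nonneg : ∀ {x y} → 0# ≤ x → 0# ≤ y → 0# ≤ x + y
  +-nonneg {x} {y} 0≤x 0≤y = ≤-trans 0≤y (subst (_≤ x + y) (+-identityˡ y) (+-monoˡ-≤ y 0≤x))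

  *-nonneg : ∀ {x y} → 0# ≤ x → 0# ≤ y → 0# ≤ x * y
  *-nonneg {x} {y} (inj₁ 0<x) (inj₁ 0<y) = inj₁ (*-pos x y 0<x 0<y)
  *-nonneg {y = y} (inj₂ refl) _ = inj₂ (sym (zeroˡ y))
  *-nonneg {x} _ (inj₂ refl) = inj₂ (sym (zeroʳ x))

  x≤0⇒0≤-x : ∀ {x} → x ≤ 0# → 0# ≤ - x
  x≤0⇒0≤-x {x} x≤0 = subst (0# ≤_) (+-identityˡ (- x)) (x≤y⇒0≤y-x x≤0)

  0≤-x⇒x≤0 : ∀ {x} → 0# ≤ - x → x ≤ 0#
  0≤-x⇒x≤0 {x} 0≤-x = 0≤y-x⇒x≤y (subst (0# ≤_) (sym (+-identityˡ (- x))) 0≤-x)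

  *-nonpos-nonneg : ∀ {x y} → x ≤ 0# → 0# ≤ y → x * y ≤ 0#
  *-nonpos-nonneg {x} {y} x≤0 0≤y = 0≤-x⇒x≤0
    (subst (0# ≤_) (solve 2 (λ x y → :- x :* y := :- (x :* y)) refl x y)
      (*-nonneg (x≤0⇒0≤-x x≤0) 0≤y))

  square-nonneg : ∀ x → 0# ≤ x * x
  square-nonneg x with ≤-total 0# x
  ... | inj₁ 0≤x = *-nonneg 0≤x 0≤x
  ... | inj₂ x≤0 = subst (0# ≤_) (solve 1 (λ x → :- x :* :- x := x :* x) refl x)
                     (*-nonneg (x≤0⇒0≤-x x≤0) (x≤0⇒0≤-x x≤0))

  0<2 : 0# < 2#
  0<2 = <-trans 0<1 (subst (_< 2#) (+-identityˡ 1#) (+-mono-< 0# 1# 1# 0<1))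

  ⁻¹-unique : ∀ {x y} → x * y ≡ 1# → y ≡ x ⁻¹
  ⁻¹-unique {x} {y} xy≡1 = ≡-modulo₂ (x ⁻¹) (- y) xy≡1 (⁻¹-inverse x x≢0)
    (solve 3 (λ x y x⁻¹ → y := x⁻¹ :+ (x :* y :- con (+ 1)) :* x⁻¹
                                 :+ (x :* x⁻¹ :- con (+ 1)) :* (:- y)) refl x y (x ⁻¹))
    where
    x≢0 : x ≢ 0#
    x≢0 refl = <-irrefl (trans (sym (zeroˡ y)) xy≡1) 0<1

  ⁻¹-distrib-* : ∀ {x y} → x ≢ 0# → y ≢ 0# → (x * y) ⁻¹ ≡ x ⁻¹ * y ⁻¹
  ⁻¹-distrib-* {x} {y} x≢0 y≢0 = sym (⁻¹-unique
    (≡-modulo₂ (y * y ⁻¹) 1# (⁻¹-inverse x x≢0) (⁻¹-inverse y y≢0)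
      (solve 4 (λ x x⁻¹ y y⁻¹ → x :* y :* (x⁻¹ :* y⁻¹)
                  := con (+ 1) :+ (x :* x⁻¹ :- con (+ 1)) :* (y :* y⁻¹)
                               :+ (y :* y⁻¹ :- con (+ 1)) :* con (+ 1))
        refl x (x ⁻¹) y (y ⁻¹))))

  ⁻¹-pos : ∀ {x} → 0# < x → 0# < x ⁻¹
  ⁻¹-pos {x} 0<x = ≤∧≢⇒< 0≤x⁻¹ (λ 0≡x⁻¹ → <-irrefl (0≡1 0≡x⁻¹) 0<1)
    where
    x*x⁻¹≡1 : x * x ⁻¹ ≡ 1#
    x*x⁻¹≡1 = ⁻¹-inverse x (>⇒≢0 0<x)
    0≤x⁻¹ : 0# ≤ x ⁻¹
    0≤x⁻¹ = subst (0# ≤_)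
      (≡-modulo (x ⁻¹) x*x⁻¹≡1 (solve 2 (λ x x⁻¹ → x :* (x⁻¹ :* x⁻¹)
         := x⁻¹ :+ (x :* x⁻¹ :- con (+ 1)) :* x⁻¹) refl x (x ⁻¹)))
      (*-nonneg (inj₁ 0<x) (square-nonneg (x ⁻¹)))
    0≡1 : 0# ≡ x ⁻¹ → 0# ≡ 1#
    0≡1 0≡x⁻¹ = trans (sym (zeroʳ x)) (trans (cong (x *_) 0≡x⁻¹) x*x⁻¹≡1)

  x≤max : ∀ x y → x ≤ max x y
  x≤max x y with compare x y
  ... | tri< x<y _ _ = inj₁ x<y
  ... | tri≈ _ x≡y _ = inj₂ x≡y
  ... | tri> _ _ _   = ≤-refl

  y≤max : ∀ x y → y ≤ max x y
  y≤max x y with compare x y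
  ... | tri< _ _ _   = ≤-refl
  ... | tri≈ _ _ _   = ≤-refl
  ... | tri> _ _ y<x = inj₁ y<x

  max0-of-nonneg : ∀ {x} → 0# ≤ x → max 0# x ≡ x
  max0-of-nonneg {x} 0≤x with compare 0# x
  ... | tri< _ _ _   = refl
  ... | tri≈ _ _ _   = refl
  ... | tri> _ _ x<0 = ⊥-elim (<⇒≱ x<0 0≤x)

  max0-of-nonpos : ∀ {x} → x ≤ 0# → max 0# x ≡ 0#
  max0-of-nonpos {x} x≤0 with compare 0# x
  ... | tri< 0<x _ _ = ⊥-elim (<⇒≱ 0<x x≤0)
  ... | tri≈ _ 0≡x _ = sym 0≡x
  ... | tri> _ _ _   = refl

  max0-pos⇒≡ : ∀ {x} → 0# < max 0# x → max 0# x ≡ x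
  max0-pos⇒≡ {x} 0<max with ≤-total x 0#
  ... | inj₁ x≤0 = ⊥-elim (<-irrefl (sym (max0-of-nonpos x≤0)) 0<max)
  ... | inj₂ 0≤x = max0-of-nonneg 0≤x

  max0-sub : ∀ {x s} → 0# ≤ s → max 0# (max 0# x - s) ≡ max 0# (x - s)
  max0-sub {x} {s} 0≤s with ≤-total x 0#
  ... | inj₂ 0≤x = cong (λ y → max 0# (y - s)) (max0-of-nonneg 0≤x)
  ... | inj₁ x≤0 = begin
    max 0# (max 0# x - s)  ≡⟨ cong (λ y → max 0# (y - s)) (max0-of-nonpos x≤0) ⟩
    max 0# (0# - s)        ≡⟨ max0-of-nonpos (x≤y⇒x-y≤0 0≤s) ⟩
    0#                     ≡⟨ max0-of-nonpos (x≤y⇒x-y≤0 (≤-trans x≤0 0≤s)) ⟨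
    max 0# (x - s)         ∎
    where open ≡-Reasoning

  max0-*-nonneg : ∀ {x c} → 0# ≤ c → max 0# x * c ≡ max 0# (x * c)
  max0-*-nonneg {x} {c} 0≤c with ≤-total x 0#
  ... | inj₂ 0≤x =
    trans (cong (_* c) (max0-of-nonneg 0≤x)) (sym (max0-of-nonneg (*-nonneg 0≤x 0≤c)))
  ... | inj₁ x≤0 = begin
    max 0# x * c    ≡⟨ cong (_* c) (max0-of-nonpos x≤0) ⟩
    0# * c          ≡⟨ zeroˡ c ⟩
    0#              ≡⟨ max0-of-nonpos (*-nonpos-nonneg x≤0 0≤c) ⟨
    max 0# (x * c)  ∎
    where open ≡-Reasoning

  max0-square≤square : ∀ x → max 0# x * max 0# x ≤ x * x
  max0-square≤square x with ≤-total x 0#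
  ... | inj₂ 0≤x = subst (λ y → y * y ≤ x * x) (sym (max0-of-nonneg 0≤x)) ≤-refl
  ... | inj₁ x≤0 = subst (λ y → y * y ≤ x * x) (sym (max0-of-nonpos x≤0))
                     (subst (_≤ x * x) (sym (zeroˡ 0#)) (square-nonneg x))

  IsSign : Carrier → Set
  IsSign σ = σ ≡ - 1# ⊎ σ ≡ 1#

  sign*sign≡1 : ∀ {σ} → IsSign σ → σ * σ ≡ 1#
  sign*sign≡1 (inj₁ refl) = solve 0 (:- con (+ 1) :* :- con (+ 1) := con (+ 1)) refl
  sign*sign≡1 (inj₂ refl) = solve 0 (con (+ 1) :* con (+ 1) := con (+ 1)) refl

  -[sign*x]≤∣x∣ : ∀ {σ} x → IsSign σ → - (σ * x) ≤ ∣ x ∣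
  -[sign*x]≤∣x∣ x (inj₁ refl) =
    subst (_≤ ∣ x ∣) (solve 1 (λ x → x := :- (:- con (+ 1) :* x)) refl x) (x≤max x (- x))
  -[sign*x]≤∣x∣ x (inj₂ refl) =
    subst (_≤ ∣ x ∣) (solve 1 (λ x → :- x := :- (con (+ 1) :* x)) refl x) (y≤max x (- x))

  sign*-bounded : ∀ {σ x b} → IsSign σ → 0# ≤ x → x ≤ b → - b ≤ σ * x × σ * x ≤ b
  sign*-bounded {x = x} {b} (inj₁ refl) 0≤x x≤b =
    subst (- b ≤_) -x≡ (neg-mono-≤ x≤b) , subst (_≤ b) -x≡ (≤-trans (-x≤x 0≤x) x≤b)
    where
    -x≡ : - x ≡ - 1# * x
    -x≡ = solve 1 (λ x → :- x := :- con (+ 1) :* x) refl x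
  sign*-bounded {x = x} {b} (inj₂ refl) 0≤x x≤b =
    subst (- b ≤_) x≡ (≤-trans (neg-mono-≤ x≤b) (-x≤x 0≤x)) , subst (_≤ b) x≡ x≤b
    where
    x≡ : x ≡ 1# * x
    x≡ = solve 1 (λ x → x := con (+ 1) :* x) refl x

module LowerTrajectory (ℝ : CompleteOrderedField) (P : ACAS.Params ℝ) where
  open CompleteOrderedField ℝ
  open OrderedFieldProperties ℝ
  open ACAS ℝ
  open Params P
  open ≡ using (refl; sym; trans; cong; cong₂; subst; module ≡-Reasoning)

  module _ (alo>0 : 0# < alo) {w vlo : Carrier} (±w : IsSign w) where

    M T : Carrier → Carrier
    M v = max 0# (w * (vlo - v))
    T v = Tlo P v w vlo

    -- A_lo as a function of t: the parabolic phase (t < T) lies (w alo / 2)(T - t)² above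
    -- the continuation of the linear phase, so one formula covers both.
    hlo : Carrier → Carrier → Carrier
    hlo v t = vlo * t - (w * alo / 2#) * (T v * T v - max 0# (T v - t) * max 0# (T v - t))

    w*w≡1 : w * w ≡ 1#
    w*w≡1 = sign*sign≡1 ±w

    alo*alo⁻¹≡1 : alo * alo ⁻¹ ≡ 1#
    alo*alo⁻¹≡1 = ⁻¹-inverse alo (>⇒≢0 alo>0)

    2*2⁻¹≡1 : 2# * 2# ⁻¹ ≡ 1#
    2*2⁻¹≡1 = ⁻¹-inverse 2# (>⇒≢0 0<2)

    T-nonneg : ∀ v → 0# ≤ T v
    T-nonneg v = *-nonneg (x≤max 0# _) (inj₁ (⁻¹-pos alo>0))

    alo*T≡M : ∀ v → alo * T v ≡ M v
    alo*T≡M v = ≡-modulo (M v) alo*alo⁻¹≡1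
      (solve 3 (λ a a⁻¹ M → a :* (M :* a⁻¹) := M :+ (a :* a⁻¹ :- con (+ 1)) :* M)
        refl alo (alo ⁻¹) (M v))

    linear-offset : ∀ v → w * (M v * M v) / (2# * alo) ≡ (w * alo / 2#) * (T v * T v)
    linear-offset v = begin
      w * (M v * M v * (2# * alo) ⁻¹)
        ≡⟨ cong₂ (λ y d → w * (y * y * d)) (sym (alo*T≡M v))
                 (⁻¹-distrib-* (>⇒≢0 0<2) (>⇒≢0 alo>0)) ⟩
      w * (alo * T v * (alo * T v) * (2# ⁻¹ * alo ⁻¹))
        ≡⟨ ≡-modulo (w * alo * 2# ⁻¹ * (T v * T v)) alo*alo⁻¹≡1
             (solve 5 (λ w a T ½ a⁻¹ → w :* (a :* T :* (a :* T) :* (½ :* a⁻¹))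
                := w :* (a :* ½) :* (T :* T)
                   :+ (a :* a⁻¹ :- con (+ 1)) :* (w :* a :* ½ :* (T :* T)))
               refl w alo (T v) (2# ⁻¹) (alo ⁻¹)) ⟩
      (w * alo / 2#) * (T v * T v) ∎
      where open ≡-Reasoning

    hlo-linear : ∀ {v t} → T v ≤ t → hlo v t ≡ vlo * t - w * (M v * M v) / (2# * alo)
    hlo-linear {v} {t} T≤t = begin
      hlo v t
        ≡⟨ cong (λ y → vlo * t - c * (T v * T v - y * y)) (max0-of-nonpos (x≤y⇒x-y≤0 T≤t)) ⟩
      vlo * t - c * (T v * T v - 0# * 0#)
        ≡⟨ solve 4 (λ vlo t c Tv → vlo :* t :- c :* (Tv :* Tv :- con (+ 0) :* con (+ 0))
                                   := vlo :* t :- c :* (Tv :* Tv)) refl vlo t c (T v) ⟩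
      vlo * t - c * (T v * T v)
        ≡⟨ cong (λ y → vlo * t - y) (sym (linear-offset v)) ⟩
      vlo * t - w * (M v * M v) / (2# * alo) ∎
      where
      open ≡-Reasoning
      c : Carrier
      c = w * alo / 2#

    hlo-parabolic : ∀ {v t} → 0# ≤ t → t < T v → hlo v t ≡ (w * alo / 2#) * (t * t) + v * t
    hlo-parabolic {v} {t} 0≤t t<T = begin
      hlo v t
        ≡⟨ cong (λ y → vlo * t - c * (T v * T v - y * y)) (max0-of-nonneg (inj₁ (x<y⇒0<y-x t<T))) ⟩
      vlo * t - c * (T v * T v - (T v - t) * (T v - t))
        ≡⟨ ≡-modulo (- (w * alo * T v * t)) 2*2⁻¹≡1
             (solve 6 (λ vlo t w a ½ Tv →
                vlo :* t :- w :* (a :* ½) :* (Tv :* Tv :- (Tv :- t) :* (Tv :- t))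
                := vlo :* t :- w :* (a :* Tv) :* t :+ w :* (a :* ½) :* (t :* t)
                   :+ (con (+ 2) :* ½ :- con (+ 1)) :* (:- (w :* a :* Tv :* t)))
               refl vlo t w alo (2# ⁻¹) (T v)) ⟩
      vlo * t - w * (alo * T v) * t + c * (t * t)
        ≡⟨ cong (λ y → vlo * t - w * y * t + c * (t * t)) alo*T≡w[vlo-v] ⟩
      vlo * t - w * (w * (vlo - v)) * t + c * (t * t)
        ≡⟨ ≡-modulo (- ((vlo - v) * t)) w*w≡1
             (solve 5 (λ vlo t w v c →
                vlo :* t :- w :* (w :* (vlo :- v)) :* t :+ c :* (t :* t)
                := c :* (t :* t) :+ v :* t :+ (w :* w :- con (+ 1)) :* (:- ((vlo :- v) :* t)))
               refl vlo t w v c) ⟩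
      c * (t * t) + v * t ∎
      where
      open ≡-Reasoning
      c : Carrier
      c = w * alo / 2#
      alo*T≡w[vlo-v] : alo * T v ≡ w * (vlo - v)
      alo*T≡w[vlo-v] = trans (alo*T≡M v) (max0-pos⇒≡ (subst (0# <_) (alo*T≡M v)
        (*-pos alo (T v) alo>0 (≤-<-trans 0≤t t<T))))

    Alo⇒hlo : ∀ {v hn t} → Alo P v w vlo hn t → 0# ≤ t × hn ≡ hlo v t
    Alo⇒hlo (inj₁ (0≤t , t<T , refl)) = 0≤t , sym (hlo-parabolic 0≤t t<T)
    Alo⇒hlo (inj₂ (T≤t , refl))       = ≤-trans (T-nonneg _) T≤t , sym (hlo-linear T≤t)

    hlo⇒Alo : ∀ {v t} → 0# ≤ t → Alo P v w vlo (hlo v t) t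
    hlo⇒Alo {v} {t} 0≤t with compare t (T v)
    ... | tri< t<T _ _ = inj₁ (0≤t , t<T , hlo-parabolic 0≤t t<T)
    ... | tri≈ _ t≡T _ = inj₂ (inj₂ (sym t≡T) , hlo-linear (inj₂ (sym t≡T)))
    ... | tri> _ _ T<t = inj₂ (inj₁ T<t , hlo-linear (inj₁ T<t))

    hlo-zero : ∀ v → hlo v 0# ≡ 0#
    hlo-zero v = begin
      hlo v 0#
        ≡⟨ cong (λ y → vlo * 0# - c * (T v * T v - y * y)) (max0-of-nonneg 0≤T-0) ⟩
      vlo * 0# - c * (T v * T v - (T v - 0#) * (T v - 0#))
        ≡⟨ solve 3 (λ vlo c Tv → vlo :* con (+ 0)
                                 :- c :* (Tv :* Tv :- (Tv :- con (+ 0)) :* (Tv :- con (+ 0)))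
                                 := con (+ 0)) refl vlo c (T v) ⟩
      0# ∎
      where
      open ≡-Reasoning
      c : Carrier
      c = w * alo / 2#
      0≤T-0 : 0# ≤ T v - 0#
      0≤T-0 = subst (0# ≤_) (solve 1 (λ Tv → Tv := Tv :- con (+ 0)) refl (T v)) (T-nonneg v)

    T-after : ∀ {v t} → 0# ≤ t → T (v + w * alo * t) ≡ max 0# (T v - t)
    T-after {v} {t} 0≤t = begin
      max 0# (w * (vlo - (v + w * alo * t))) * alo ⁻¹
        ≡⟨ cong (λ y → max 0# y * alo ⁻¹) (≡-modulo (- (alo * t)) w*w≡1
             (solve 5 (λ w vlo v a t → w :* (vlo :- (v :+ w :* a :* t))
                := w :* (vlo :- v) :- a :* t :+ (w :* w :- con (+ 1)) :* (:- (a :* t)))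
               refl w vlo v alo t)) ⟩
      max 0# (x - alo * t) * alo ⁻¹
        ≡⟨ max0-*-nonneg 0≤alo⁻¹ ⟩
      max 0# ((x - alo * t) * alo ⁻¹)
        ≡⟨ cong (max 0#) (≡-modulo (- t) alo*alo⁻¹≡1
             (solve 4 (λ x a t a⁻¹ → (x :- a :* t) :* a⁻¹
                := x :* a⁻¹ :- t :+ (a :* a⁻¹ :- con (+ 1)) :* (:- t))
               refl x alo t (alo ⁻¹))) ⟩
      max 0# (x * alo ⁻¹ - t)
        ≡⟨ max0-sub 0≤t ⟨
      max 0# (max 0# (x * alo ⁻¹) - t)
        ≡⟨ cong (λ y → max 0# (y - t)) (max0-*-nonneg 0≤alo⁻¹) ⟨
      max 0# (T v - t) ∎
      where
      open ≡-Reasoning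
      x : Carrier
      x = w * (vlo - v)
      0≤alo⁻¹ : 0# ≤ alo ⁻¹
      0≤alo⁻¹ = inj₁ (⁻¹-pos alo>0)

    hlo-flow : ∀ {v t s} → 0# ≤ t → 0# ≤ s → hlo v (t + s) ≡ hlo v t + hlo (v + w * alo * t) s
    hlo-flow {v} {t} {s} 0≤t 0≤s = begin
      hlo v (t + s)
        ≡⟨ solve 7 (λ vlo c Tv ν μ t s → vlo :* (t :+ s) :- c :* (Tv :* Tv :- μ :* μ)
             := (vlo :* t :- c :* (Tv :* Tv :- ν :* ν)) :+ (vlo :* s :- c :* (ν :* ν :- μ :* μ)))
             refl vlo c (T v) ν μ t s ⟩
      hlo v t + (vlo * s - c * (ν * ν - μ * μ))
        ≡⟨ cong (λ y → hlo v t + y)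
                (cong₂ (λ T′ μ′ → vlo * s - c * (T′ * T′ - μ′ * μ′)) (T-after 0≤t) μ′≡μ) ⟨
      hlo v t + hlo v′ s ∎
      where
      open ≡-Reasoning
      c : Carrier
      c = w * alo / 2#
      v′ ν μ : Carrier
      v′ = v + w * alo * t
      ν = max 0# (T v - t)
      μ = max 0# (T v - (t + s))
      μ′≡μ : max 0# (T v′ - s) ≡ μ
      μ′≡μ = begin
        max 0# (T v′ - s)       ≡⟨ cong (λ y → max 0# (y - s)) (T-after 0≤t) ⟩
        max 0# (ν - s)          ≡⟨ max0-sub 0≤s ⟩
        max 0# (T v - t - s)    ≡⟨ cong (max 0#) (solve 3 (λ Tv t s → Tv :- t :- s := Tv :- (t :+ s))
                                                           refl (T v) t s) ⟩
        μ                       ∎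

    hlo-bound : ∀ {v t} → 0# ≤ t → w * hlo v t ≤ w * (v * t + ((w * alo) / 2#) * (t * t))
    hlo-bound {v} {t} 0≤t = 0≤y-x⇒x≤y (subst (0# ≤_) (sym gap≡) 0≤gap)
      where
      x : Carrier
      x = w * (vlo - v)
      ν gap : Carrier
      ν = max 0# (T v - t)
      gap = (alo * T v - x) * t + (alo * 2# ⁻¹) * ((T v - t) * (T v - t) - ν * ν)
      gap≡ : w * (v * t + ((w * alo) / 2#) * (t * t)) - w * hlo v t ≡ gap
      gap≡ = ≡-modulo₂ (alo * 2# ⁻¹ * (t * t + T v * T v - ν * ν)) (alo * T v * t) w*w≡1 2*2⁻¹≡1
        (solve 8 (λ w v t a ½ vlo Tv ν →
           w :* (v :* t :+ (w :* a :* ½) :* (t :* t))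
             :- w :* (vlo :* t :- w :* (a :* ½) :* (Tv :* Tv :- ν :* ν))
           := (a :* Tv :- w :* (vlo :- v)) :* t :+ (a :* ½) :* ((Tv :- t) :* (Tv :- t) :- ν :* ν)
              :+ (w :* w :- con (+ 1)) :* (a :* ½ :* (t :* t :+ Tv :* Tv :- ν :* ν))
              :+ (con (+ 2) :* ½ :- con (+ 1)) :* (a :* Tv :* t))
          refl w v t alo (2# ⁻¹) vlo (T v) ν)
      0≤gap : 0# ≤ gap
      0≤gap = +-nonneg
        (*-nonneg (subst (λ y → 0# ≤ y - x) (sym (alo*T≡M v)) (x≤y⇒0≤y-x (y≤max 0# x))) 0≤t)
        (*-nonneg (inj₁ (*-pos alo (2# ⁻¹) alo>0 (⁻¹-pos 0<2)))
                  (x≤y⇒0≤y-x (max0-square≤square (T v - t))))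

    Limpl-invariant : ∀ {r h v t} → 0# ≤ t → Limpl P r h v w vlo →
      Limpl P (r - rv * t) (h - (v * t + ((w * alo) / 2#) * (t * t))) (v + w * alo * t) w vlo
    Limpl-invariant {r} {h} {v} {t} 0≤t L s _ _ refl A′ with Alo⇒hlo A′
    ... | 0≤s , refl =
      Sum.map horizontal vertical (L (t + s) _ _ refl (hlo⇒Alo (+-nonneg 0≤t 0≤s)))
      where
      v′ h′ : Carrier
      v′ = v + w * alo * t
      h′ = h - (v * t + ((w * alo) / 2#) * (t * t))

      horizontal : rp < ∣ r - rv * (t + s) ∣ → rp < ∣ r - rv * t - rv * s ∣
      horizontal = subst (λ d → rp < ∣ d ∣)
        (solve 4 (λ r rv t s → r :- rv :* (t :+ s) := r :- rv :* t :- rv :* s) refl r rv t s)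

      vertical : hp < w * (hlo v (t + s) - h) → hp < w * (hlo v′ s - h′)
      vertical hp< = <-≤-trans hp< (begin
        w * (hlo v (t + s) - h)
          ≡⟨ cong (λ y → w * (y - h)) (hlo-flow 0≤t 0≤s) ⟩
        w * (hlo v t + hlo v′ s - h)
          ≡⟨ solve 4 (λ w H H′ h → w :* (H :+ H′ :- h) := w :* H :+ (w :* H′ :- w :* h))
                 refl w (hlo v t) (hlo v′ s) h ⟩
        w * hlo v t + (w * hlo v′ s - w * h)
          ≤⟨ +-monoˡ-≤ _ (hlo-bound 0≤t) ⟩
        w * (v * t + ((w * alo) / 2#) * (t * t)) + (w * hlo v′ s - w * h)
          ≡⟨ solve 4 (λ w d H′ h → w :* d :+ (w :* H′ :- w :* h) := w :* (H′ :- (h :- d)))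
               refl w (v * t + ((w * alo) / 2#) * (t * t)) (hlo v′ s) h ⟩
        w * (hlo v′ s - h′) ∎)
        where open import Relation.Binary.Reasoning.StrictPartialOrder strictPartialOrder

    Limpl⇒safe : ∀ {r h v} → Limpl P r h v w vlo → rp < ∣ r ∣ ⊎ hp < ∣ h ∣
    Limpl⇒safe {r} {h} {v} L = Sum.map horizontal vertical (L 0# _ _ refl (hlo⇒Alo ≤-refl))
      where
      horizontal : rp < ∣ r - rv * 0# ∣ → rp < ∣ r ∣
      horizontal = subst (λ d → rp < ∣ d ∣)
        (solve 2 (λ r rv → r :- rv :* con (+ 0) := r) refl r rv)

      vertical : hp < w * (hlo v 0# - h) → hp < ∣ h ∣
      vertical hp< = <-≤-trans hp< (begin
        w * (hlo v 0# - h)  ≡⟨ cong (λ y → w * (y - h)) (hlo-zero v) ⟩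
        w * (0# - h)        ≡⟨ solve 2 (λ w h → w :* (con (+ 0) :- h) := :- (w :* h)) refl w h ⟩
        - (w * h)           ≤⟨ -[sign*x]≤∣x∣ h ±w ⟩
        ∣ h ∣               ∎)
        where open import Relation.Binary.Reasoning.StrictPartialOrder strictPartialOrder

module Game (ℝ : CompleteOrderedField) (P : ACAS.Params ℝ) where
  open CompleteOrderedField ℝ
  open OrderedFieldProperties ℝ
  open ACAS ℝ
  open Params P
  open LowerTrajectory ℝ P

  Invariant : State → Set
  Invariant (state r h v w vlo _) = IsSign w × Limpl P r h v w vlo

  module _ (alo>0 : 0# < alo) (alo≤amax : alo ≤ amax) where

    follow-advisory : ∀ s → Invariant s → BoxCtrlDual P (BoxODE P Invariant) s
    follow-advisory (state r h v w vlo ao) (±w , L) =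
      w * alo , sign*-bounded ±w (inj₁ alo>0) alo≤amax ,
      λ _ 0≤t → ±w , Limpl-invariant alo>0 ±w 0≤t L

    Invariant-closed : ∀ s → Invariant s → Safe P s × BoxAlpha1 P Invariant s
    Invariant-closed s@(state r h v w vlo ao) inv@(±w , L) =
      Limpl⇒safe alo>0 ±w L ,
      follow-advisory s inv ,
      λ w′ ±w′ vlo′ L′ → follow-advisory (state r h v w′ vlo′ ao) (Sum.swap ±w′ , L′)

theorem3p2 : (ℝ : CompleteOrderedField) → (P : ACAS.Params ℝ) → (s : ACAS.State ℝ) →
    ACAS.Pre ℝ P s → ACAS.BoxAlpha1Star ℝ P (ACAS.Safe ℝ P) s
theorem3p2 ℝ P (ACAS.state r h v w vlo ao) (_ , _ , _ , alo>0 , ±w , alo≤amax , L) =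
  Invariant , (±w , L) , Invariant-closed alo>0 alo≤amax
  where open Game ℝ P
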